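{- Let $n\geq 4$ and $i_1,j_1,i_2,j_2,a,b\in[n]$ with $i_1<j_1$, $i_2<j_2$. Then: (1) $\#\mathcal{S}_n^{i_1j_1}{}_{|\bar i_2=j_1,\bar j_2=i_1}=\#\mathcal{S}_n^{j_1i_1}{}_{|\bar i_2=i_1,\bar j_2=j_1}=(n-2)!$; (2) if $a,b\notin\{i_1,j_1\}$: $\#\mathcal{S}_n^{i_1j_1}{}_{|\bar i_2=a,\bar j_2=b}=\#\mathcal{S}_n^{j_1i_1}{}_{|\bar i_2=a,\bar j_2=b}=\frac{(n-2)!}{2}$; (3) if $b\notin\{i_1,j_1\}$: $\#\mathcal{S}_n^{i_1j_1}{}_{|\bar i_2=i_1,\bar j_2=b}=(i_2-1)(n-3)!$ and $\#\mathcal{S}_n^{j_1i_1}{}_{|\bar i_2=i_1,\bar j_2=b}=(n-i_2-1)(n-3)!$; (4) if $a\notin\{i_1,j_1\}$: $\#\mathcal{S}_n^{i_1j_1}{}_{|\bar i_2=a,\bar j_2=i_1}=(j_2-2)(n-3)!$ and $\#\mathcal{S}_n^{j_1i_1}{}_{|\bar i_2=a,\bar j_2=i_1}=(n-j_2)(n-3)!$; (5) if $b\notin\{i_1,j_1\}$: $\#\mathcal{S}_n^{i_1j_1}{}_{|\bar i_2=j_1,\bar j_2=b}=(n-i_2-1)(n-3)!$ and $\#\mathcal{S}_n^{j_1i_1}{}_{|\bar i_2=j_1,\bar j_2=b}=(i_2-1)(n-3)!$; (6) if $a\notin\{i_1,j_1\}$: $\#\mathcal{S}_n^{i_1j_1}{}_{|\bar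 i_2=a,\bar j_2=j_1}=(n-j_2)(n-3)!$ and $\#\mathcal{S}_n^{j_1i_1}{}_{|\bar i_2=a,\bar j_2=j_1}=(j_2-2)(n-3)!$.
   Context: $\mathcal{S}_n$ is the symmetric group on $[n]$. For $p,q\in[n]$, $\mathcal{S}_n^{p\,q}=\{\sigma\in\mathcal{S}_n:\sigma(p)>\sigma(q)\}$, and for $r,s,a,b\in[n]$, $\mathcal{S}_n^{p\,q}{}_{|\bar r=a,\bar s=b}=\{\sigma\in\mathcal{S}_n^{p\,q}:\sigma^{ -1}(r)=a,\ \sigma^{ -1}(s)=b\}$. -}

module Defs where

open import Data.Nat using (ℕ; zero; suc)
open import Data.Fin using (Fin; toℕ; _<?_)
open import Data.Fin.Properties using (_≟_)
open import Data.Vec using (Vec; []; _∷_; lookup; toList)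
open import Data.List using (List; []; _∷_; map; concatMap; filter; length; allFin)
open import Data.List.Relation.Unary.AllPairs using (allPairs?)
open import Relation.Nullary.Decidable using (¬?)
open import Relation.Nullary.Decidable using (_×-dec_)

-- The elements of [n] = {1,…,n} are represented by Fin n; the element
-- k : Fin n stands for  pos k = toℕ k + 1  ∈ [n].
pos : ∀ {n} → Fin n → ℕ
pos k = suc (toℕ k)

words : (n k : ℕ) → List (Vec (Fin n) k)
words n zero    = [] ∷ []
words n (suc k) = concatMap (λ x → map (x ∷_) (words n k)) (allFin n)

-- A permutation σ ∈ S_n is represented in one-line notation as the vector
-- (σ(1), …, σ(n)), i.e. σ(i) = lookup σ i.
isPerm? : ∀ {n} (σ : Vec (Fin n) n) → _
isPerm? σ = allPairs? (λ x y → ¬? (x ≟ y)) (toList σ)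

Sym : (n : ℕ) → List (Vec (Fin n) n)
Sym n = filter isPerm? (words n n)

Spq : (n : ℕ) → (p q : Fin n) → List (Vec (Fin n) n)
Spq n p q = filter (λ σ → lookup σ q <? lookup σ p) (Sym n)

-- S_n^{p q}|_{r̄=a, s̄=b} = { σ ∈ S_n^{p q} : σ⁻¹(r) = a, σ⁻¹(s) = b },
-- where σ⁻¹(r) = a is the condition σ(a) = r.
SpqRestr : (n : ℕ) → (p q r s a b : Fin n) → List (Vec (Fin n) n)
SpqRestr n p q r s a b =
  filter (λ σ → (lookup σ a ≟ r) ×-dec (lookup σ b ≟ s)) (Spq n p q)

-- cardinality of a finite set given as a repetition-free list
#_ : ∀ {A : Set} → List A → ℕ
# xs = length xs

-- The central general fact is
-- count-constrained: the injective words of length k over Fin n whose letters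
-- at c distinct positions are prescribed (by c distinct letters) number
-- (n - c)(n - c - 1)⋯ with k - c factors, hence (n - c)! permutations.  It is
-- proved by induction on k, through patterns whose free positions must avoid the
-- letters reserved so far (count-fillings).  The lemma then follows by
-- classifying permutations by their letters at the unconstrained compared
-- positions (count-fibres):
--  (1) both compared positions are constrained, and σ(q) < σ(p) reads r < s;
--  (2) neither is: the count ∑_{t₂ < t₁} [r, s, t₁, t₂ distinct] (n - 4)! is the
--      same for both orders of p and q, which together give (n - 2)!;
--  (3)–(6) exactly one is: the count is (n - 3)! times the number of letters
--      t ∉ {r, s} lying on the appropriate side of r or of s.

module Submission where

open import Defs
open import Level using (Level)
open import Data.Bool using (true; false; if_then_else_)
open import Data.Nat using (ℕ; zero; suc; pred; _+_; _∸_; _*_; _!; _/_; _≤_)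
open import Data.Nat.DivMod using (m*n/n≡m)
open import Data.Nat.Properties
  using (+-*-semiring; *-comm; *-assoc; *-identityʳ; *-identityˡ; *-distribʳ-+; +-identityʳ; *-zeroʳ;
         m+n∸n≡m; +-suc; pred[m∸n]≡m∸[1+n])
open import Data.Fin using (Fin; zero; suc; toℕ; _<_; _<?_)
open import Data.Fin.Properties using (_≟_; all?; suc-injective; <⇒≢; <-asym; <-cmp; <-irrefl)
open import Data.List using (List; []; _∷_; map; concatMap; filter; length; tabulate; _++_)
open import Data.List.Properties using (length-++; length-map; filter-++; filter-≐; filter-none)
import Data.List.Relation.Unary.All as All
open import Data.List.Relation.Unary.All using (All; []; _∷_)
open import Data.List.Relation.Unary.All.Properties.Core using (¬Any⇒All¬)
open import Data.List.Relation.Unary.Any using (any?; here; there)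
open import Data.List.Relation.Unary.AllPairs using (allPairs?)
open import Data.List.Relation.Unary.Unique.Propositional using (Unique; []; _∷_)
open import Data.List.Membership.Propositional using (_∈_; _∉_)
open import Data.List.Membership.Propositional.Properties using (∈-map⁺; ∈-map⁻)
open import Data.Vec using (Vec; []; _∷_; lookup; toList)
import Data.Vec.Relation.Unary.All.Properties as VecAll
open import Data.Maybe using (Maybe; just; nothing)
open import Data.Product using (_×_; _,_; proj₁; proj₂; ∃)
open import Relation.Nullary using (Dec; yes; no; ¬_; does; contradiction)
open import Relation.Nullary.Decidable using (_×-dec_; ¬?)
open import Relation.Unary using (Pred; Decidable; _≐_; _⊆_; _∩_; ∁)
open import Relation.Unary.Properties using (_∩?_; ∁?)
open import Relation.Binary using (tri<; tri≈; tri>)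
open import Relation.Binary.PropositionalEquality
open import Algebra.Properties.Semiring.Sum +-*-semiring
  using (sum-syntax; sum-cong-≗; ∑-distrib-+; *-distribʳ-sum)
open import Function using (_∘_; case_of_; _⇔_; Equivalence; mk⇔)

private variable
  α ℓ ℓ′ : Level
  A : Set α
  n k : ℕ

-- 𝟙 d is 1 if the decided proposition holds and 0 otherwise.  It is defined
-- through the boolean 'does d', so that it computes through 'map′'.
𝟙 : {P : Set ℓ} → Dec P → ℕ
𝟙 d = if does d then 1 else 0

𝟙-yes : {P : Set ℓ} → P → (d : Dec P) → 𝟙 d ≡ 1
𝟙-yes p (yes _) = refl
𝟙-yes p (no ¬p) = contradiction p ¬p

𝟙-no : {P : Set ℓ} → ¬ P → (d : Dec P) → 𝟙 d ≡ 0
𝟙-no ¬p (yes p) = contradiction p ¬p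
𝟙-no ¬p (no _)  = refl

𝟙-cong : {P : Set ℓ} {Q : Set ℓ′} → (P → Q) → (Q → P) → (d : Dec P) (e : Dec Q) → 𝟙 d ≡ 𝟙 e
𝟙-cong f g (yes p) e = sym (𝟙-yes (f p) e)
𝟙-cong f g (no ¬p) e = sym (𝟙-no (¬p ∘ g) e)

𝟙-guarded : {P : Set ℓ} (d : Dec P) {a b : ℕ} → (P → a ≡ b) → 𝟙 d * a ≡ 𝟙 d * b
𝟙-guarded (yes p) a≡b = cong (_+ 0) (a≡b p)
𝟙-guarded (no _)  _   = refl

module _ {A : Set α} {P : Pred A ℓ} (P? : Decidable P) where

  count : List A → ℕ
  count xs = length (filter P? xs)

  count-∷ : ∀ x xs → count (x ∷ xs) ≡ 𝟙 (P? x) + count xs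
  count-∷ x xs with does (P? x)
  ... | true  = refl
  ... | false = refl

  count-++ : ∀ xs ys → count (xs ++ ys) ≡ count xs + count ys
  count-++ xs ys = trans (cong length (filter-++ P? xs ys)) (length-++ (filter P? xs))

  count-complement : ∀ xs → count xs + length (filter (∁? P?) xs) ≡ length xs
  count-complement []       = refl
  count-complement (x ∷ xs) with does (P? x)
  ... | true  = cong suc (count-complement xs)
  ... | false = trans (+-suc (count xs) _) (cong suc (count-complement xs))

count-filter : {P : Pred A ℓ} {Q : Pred A ℓ′} (P? : Decidable P) (Q? : Decidable Q) →
  ∀ xs → count Q? (filter P? xs) ≡ count (P? ∩? Q?) xs
count-filter P? Q? []       = refl
count-filter P? Q? (x ∷ xs) with does (P? x)
... | false = count-filter P? Q? xs
... | true  with does (Q? x)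
...   | true  = cong suc (count-filter P? Q? xs)
...   | false = count-filter P? Q? xs

count-split : {P : Pred A ℓ} {Q : Pred A ℓ′} (P? : Decidable P) (Q? : Decidable Q) →
  ∀ xs → count P? xs ≡ count (P? ∩? Q?) xs + count (P? ∩? ∁? Q?) xs
count-split P? Q? xs = begin
  count P? xs                                              ≡⟨ count-complement Q? (filter P? xs) ⟨
  count Q? (filter P? xs) + count (∁? Q?) (filter P? xs)   ≡⟨ cong₂ _+_ (count-filter P? Q? xs) (count-filter P? (∁? Q?) xs) ⟩
  count (P? ∩? Q?) xs + count (P? ∩? ∁? Q?) xs             ∎
  where open ≡-Reasoning

count-cong : {P : Pred A ℓ} {Q : Pred A ℓ′} (P? : Decidable P) (Q? : Decidable Q) →
  P ≐ Q → ∀ xs → count P? xs ≡ count Q? xs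
count-cong P? Q? P≐Q xs = cong length (filter-≐ P? Q? P≐Q xs)

count-none : {P : Pred A ℓ} (P? : Decidable P) → (∀ x → ¬ P x) → ∀ xs → count P? xs ≡ 0
count-none P? none xs = cong length (filter-none P? {xs} (All.tabulate λ {x} _ → none x))

count-guard : {B : Set ℓ} {Q : Pred A ℓ′} (b? : Dec B) (Q? : Decidable Q) →
  ∀ xs → count (λ x → b? ×-dec Q? x) xs ≡ 𝟙 b? * count Q? xs
count-guard (yes b) Q? xs = trans (count-cong _ Q? (proj₂ , (b ,_)) xs) (sym (+-identityʳ _))
count-guard (no ¬b) Q? xs = count-none _ (λ _ → ¬b ∘ proj₁) xs

count-map : {B : Set} {P : Pred B ℓ} (P? : Decidable P) (h : A → B) →
  ∀ xs → count P? (map h xs) ≡ count (P? ∘ h) xs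
count-map P? h []       = refl
count-map P? h (x ∷ xs) with does (P? (h x))
... | true  = cong suc (count-map P? h xs)
... | false = count-map P? h xs

∑-const : ∀ n c → ∑[ i < n ] c ≡ n * c
∑-const zero    c = refl
∑-const (suc n) c = cong (c +_) (∑-const n c)

∑-zero : ∀ n → ∑[ i < n ] 0 ≡ 0
∑-zero n = trans (∑-const n 0) (*-zeroʳ n)

∑-pick : (u : Fin n) (f : Fin n → ℕ) → ∑[ i < n ] (𝟙 (i ≟ u) * f i) ≡ f u
∑-pick {suc n} zero    f = trans (cong₂ _+_ (+-identityʳ (f zero)) (∑-zero n)) (+-identityʳ (f zero))
∑-pick {suc n} (suc u) f = ∑-pick u (f ∘ suc)

∑-point : (u : Fin n) → ∑[ i < n ] 𝟙 (i ≟ u) ≡ 1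
∑-point u = trans (sum-cong-≗ (λ i → sym (*-identityʳ (𝟙 (i ≟ u))))) (∑-pick u (λ _ → 1))

count-fibres : {P : Pred A ℓ} (P? : Decidable P) (f : A → Fin n) →
  ∀ xs → count P? xs ≡ ∑[ t < n ] count (P? ∩? λ x → f x ≟ t) xs
count-fibres {n = n} P? f []       = sym (∑-zero n)
count-fibres {n = n} {P = P} P? f (x ∷ xs) = begin
  count P? (x ∷ xs)                                                 ≡⟨ count-∷ P? x xs ⟩
  𝟙 (P? x) + count P? xs                                            ≡⟨ cong₂ _+_ (∑-pick (f x) (λ _ → 𝟙 (P? x))) (sym (count-fibres P? f xs)) ⟨
  ∑[ t < n ] (𝟙 (t ≟ f x) * 𝟙 (P? x)) + ∑[ t < n ] count (fibre t) xs ≡⟨ ∑-distrib-+ (λ t → 𝟙 (t ≟ f x) * 𝟙 (P? x)) _ ⟨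
  ∑[ t < n ] (𝟙 (t ≟ f x) * 𝟙 (P? x) + count (fibre t) xs)          ≡⟨ sum-cong-≗ (λ t → trans (cong (_+ count (fibre t) xs) (in-fibre t (P? x))) (sym (count-∷ (fibre t) x xs))) ⟩
  ∑[ t < n ] count (fibre t) (x ∷ xs)                               ∎
  where
  open ≡-Reasoning
  fibre : (t : Fin n) → Decidable (P ∩ λ y → f y ≡ t)
  fibre t = P? ∩? λ y → f y ≟ t
  in-fibre : ∀ t (d : Dec (P x)) → 𝟙 (t ≟ f x) * 𝟙 d ≡ 𝟙 (d ×-dec (f x ≟ t))
  in-fibre t (yes _) = trans (*-identityʳ _) (𝟙-cong sym sym (t ≟ f x) (f x ≟ t))
  in-fibre t (no _)  = *-zeroʳ (𝟙 (t ≟ f x))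

infix 4 _∈?_
_∈?_ : (x : Fin n) (S : List (Fin n)) → Dec (x ∈ S)
x ∈? S = any? (x ≟_) S

∑-∈ : {S : List (Fin n)} → Unique S → ∑[ x < n ] 𝟙 (x ∈? S) ≡ length S
∑-∈ {n} {[]}    _             = ∑-zero n
∑-∈ {n} {y ∷ S} (y∉S ∷ S-unique) = begin
  ∑[ x < n ] 𝟙 (x ∈? y ∷ S)                    ≡⟨ sum-cong-≗ split ⟩
  ∑[ x < n ] (𝟙 (x ≟ y) + 𝟙 (x ∈? S))         ≡⟨ ∑-distrib-+ (λ x → 𝟙 (x ≟ y)) _ ⟩
  ∑[ x < n ] 𝟙 (x ≟ y) + ∑[ x < n ] 𝟙 (x ∈? S) ≡⟨ cong₂ _+_ (∑-point y) (∑-∈ S-unique) ⟩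
  suc (length S)                               ∎
  where
  open ≡-Reasoning
  split : ∀ x → 𝟙 (x ∈? y ∷ S) ≡ 𝟙 (x ≟ y) + 𝟙 (x ∈? S)
  split x with x ≟ y | x ∈? S
  ... | yes refl | yes x∈S = contradiction refl (All.lookup y∉S x∈S)
  ... | yes _    | no _    = refl
  ... | no _     | yes _   = refl
  ... | no _     | no _    = refl

∑-∉ : {S : List (Fin n)} → Unique S → ∑[ x < n ] 𝟙 (¬? (x ∈? S)) ≡ n ∸ length S
∑-∉ {n} {S} S-unique = trans (sym (m+n∸n≡m outside (length S))) (cong (_∸ length S) total)
  where
  open ≡-Reasoning
  outside : ℕ
  outside = ∑[ x < n ] 𝟙 (¬? (x ∈? S))
  excluded-middle : ∀ {P : Set} (d : Dec P) → 𝟙 (¬? d) + 𝟙 d ≡ 1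
  excluded-middle (yes _) = refl
  excluded-middle (no _)  = refl
  total : outside + length S ≡ n
  total = begin
    outside + length S                          ≡⟨ cong (outside +_) (∑-∈ S-unique) ⟨
    outside + ∑[ x < n ] 𝟙 (x ∈? S)             ≡⟨ ∑-distrib-+ (λ x → 𝟙 (¬? (x ∈? S))) _ ⟨
    ∑[ x < n ] (𝟙 (¬? (x ∈? S)) + 𝟙 (x ∈? S))  ≡⟨ sum-cong-≗ (λ x → excluded-middle (x ∈? S)) ⟩
    ∑[ x < n ] 1                                ≡⟨ ∑-const n 1 ⟩
    n * 1                                       ≡⟨ *-identityʳ n ⟩
    n                                           ∎

∑-below : (u : Fin n) → ∑[ t < n ] 𝟙 (t <? u) ≡ toℕ u
∑-below {suc n} zero    = ∑-zero n
∑-below {suc n} (suc u) = cong suc (∑-below u)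

∑-above : (u : Fin n) → ∑[ t < n ] 𝟙 (u <? t) ≡ n ∸ suc (toℕ u)
∑-above {suc n} zero    = trans (∑-const n 1) (*-identityʳ n)
∑-above {suc n} (suc u) = ∑-above u

distinct? : (xs : List (Fin n)) → Dec (Unique xs)
distinct? = allPairs? (λ x y → ¬? (x ≟ y))

distinct₂ : ∀ {x y : A} → x ≢ y → Unique (x ∷ y ∷ [])
distinct₂ x≢y = (x≢y ∷ []) ∷ [] ∷ []

distinct₃ : ∀ {x y z : A} → x ≢ y → x ≢ z → y ≢ z → Unique (x ∷ y ∷ z ∷ [])
distinct₃ x≢y x≢z y≢z = (x≢y ∷ x≢z ∷ []) ∷ (y≢z ∷ []) ∷ [] ∷ []

distinct₄ : ∀ {x y z v : A} → x ≢ y → x ≢ z → x ≢ v → y ≢ z → y ≢ v → z ≢ v → Unique (x ∷ y ∷ z ∷ v ∷ [])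
distinct₄ x≢y x≢z x≢v y≢z y≢v z≢v = (x≢y ∷ x≢z ∷ x≢v ∷ []) ∷ (y≢z ∷ y≢v ∷ []) ∷ (z≢v ∷ []) ∷ [] ∷ []

∑-avoiding : ∀ {r s : Fin n} → r ≢ s → (f : Fin n → ℕ) →
  ∑[ t < n ] (𝟙 (distinct? (r ∷ s ∷ t ∷ [])) * f t) ≡ ∑[ t < n ] f t ∸ (f r + f s)
∑-avoiding {n} {r} {s} r≢s f = sym (trans (cong (_∸ (f r + f s)) total) (m+n∸n≡m _ (f r + f s)))
  where
  open ≡-Reasoning
  avoids : Fin n → ℕ
  avoids t = 𝟙 (distinct? (r ∷ s ∷ t ∷ []))
  trichotomy : ∀ t (d : Dec (Unique (r ∷ s ∷ t ∷ []))) (d-r : Dec (t ≡ r)) (d-s : Dec (t ≡ s)) →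
    𝟙 d + (𝟙 d-r + 𝟙 d-s) ≡ 1
  trichotomy t _                              (yes refl) (yes refl) = contradiction refl r≢s
  trichotomy t (yes ((_ ∷ t≢t ∷ []) ∷ _))     (yes refl) (no _)     = contradiction refl t≢t
  trichotomy t (no _)                         (yes refl) (no _)     = refl
  trichotomy t (yes (_ ∷ (t≢t ∷ []) ∷ _))     (no _)     (yes refl) = contradiction refl t≢t
  trichotomy t (no _)                         (no _)     (yes refl) = refl
  trichotomy t (yes _)                        (no _)     (no _)     = refl
  trichotomy t (no repeated)                  (no t≢r)   (no t≢s)   =
    contradiction (distinct₃ r≢s (t≢r ∘ sym) (t≢s ∘ sym)) repeated
  split : ∀ t → f t ≡ avoids t * f t + (𝟙 (t ≟ r) * f t + 𝟙 (t ≟ s) * f t)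
  split t = begin
    f t                                                       ≡⟨ *-identityˡ (f t) ⟨
    1 * f t                                                   ≡⟨ cong (_* f t) (trichotomy t (distinct? _) (t ≟ r) (t ≟ s)) ⟨
    (avoids t + (𝟙 (t ≟ r) + 𝟙 (t ≟ s))) * f t                ≡⟨ *-distribʳ-+ (f t) (avoids t) _ ⟩
    avoids t * f t + (𝟙 (t ≟ r) + 𝟙 (t ≟ s)) * f t            ≡⟨ cong (avoids t * f t +_) (*-distribʳ-+ (f t) (𝟙 (t ≟ r)) _) ⟩
    avoids t * f t + (𝟙 (t ≟ r) * f t + 𝟙 (t ≟ s) * f t)      ∎
  total : ∑[ t < n ] f t ≡ ∑[ t < n ] (avoids t * f t) + (f r + f s)
  total = begin
    ∑[ t < n ] f t
      ≡⟨ sum-cong-≗ split ⟩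
    ∑[ t < n ] (avoids t * f t + (𝟙 (t ≟ r) * f t + 𝟙 (t ≟ s) * f t))
      ≡⟨ ∑-distrib-+ (λ t → avoids t * f t) _ ⟩
    ∑[ t < n ] (avoids t * f t) + ∑[ t < n ] (𝟙 (t ≟ r) * f t + 𝟙 (t ≟ s) * f t)
      ≡⟨ cong (∑[ t < n ] (avoids t * f t) +_) (∑-distrib-+ (λ t → 𝟙 (t ≟ r) * f t) _) ⟩
    ∑[ t < n ] (avoids t * f t) + (∑[ t < n ] (𝟙 (t ≟ r) * f t) + ∑[ t < n ] (𝟙 (t ≟ s) * f t))
      ≡⟨ cong (∑[ t < n ] (avoids t * f t) +_) (cong₂ _+_ (∑-pick r f) (∑-pick s f)) ⟩
    ∑[ t < n ] (avoids t * f t) + (f r + f s) ∎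

count-concatMap : ∀ {B : Set} {P : Pred A ℓ} (P? : Decidable P) (g : B → List A) (h : Fin n → B) →
  count P? (concatMap g (tabulate h)) ≡ ∑[ i < n ] count P? (g (h i))
count-concatMap {n = zero}  P? g h = refl
count-concatMap {n = suc n} P? g h =
  trans (count-++ P? (g (h zero)) _) (cong (count P? (g (h zero)) +_) (count-concatMap P? g (h ∘ suc)))

count-words-suc : {P : Pred (Vec (Fin n) (suc k)) ℓ} (P? : Decidable P) →
  count P? (words n (suc k)) ≡ ∑[ x < n ] count (P? ∘ (x ∷_)) (words n k)
count-words-suc {n} {k} P? =
  trans (count-concatMap P? (λ x → map (x ∷_) (words n k)) (λ x → x))
        (sum-cong-≗ λ x → count-map P? (x ∷_) (words n k))

-- A word is injective when its letters are pairwise distinct; the permutations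
-- of Defs are exactly the injective words of length n (isPerm? = injective?).
Injective : Vec (Fin n) k → Set
Injective w = Unique (toList w)

injective? : (w : Vec (Fin n) k) → Dec (Injective w)
injective? w = distinct? (toList w)

lookup-injective : (w : Vec (Fin n) k) → Injective w → ∀ i j → lookup w i ≡ lookup w j → i ≡ j
lookup-injective (x ∷ w) (x∉w ∷ inj) zero    zero    _ = refl
lookup-injective (x ∷ w) (x∉w ∷ inj) zero    (suc j) e = contradiction e (VecAll.lookup⁺ (VecAll.toList⁻ x∉w) j)
lookup-injective (x ∷ w) (x∉w ∷ inj) (suc i) zero    e = contradiction (sym e) (VecAll.lookup⁺ (VecAll.toList⁻ x∉w) i)
lookup-injective (x ∷ w) (x∉w ∷ inj) (suc i) (suc j) e = cong suc (lookup-injective w inj i j e)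

fresh-∷ : ∀ {x} (w : Vec (Fin n) k) → (∀ i → x ≢ lookup w i) → Injective w → Injective (x ∷ w)
fresh-∷ w fresh inj = VecAll.toList⁺ (VecAll.lookup⁻ fresh) ∷ inj

-- A pattern for words of length k prescribes at each position either a letter
-- (just u) or nothing (a free position).
Pattern : ℕ → ℕ → Set
Pattern n k = Fin k → Maybe (Fin n)

Fits : List (Fin n) → Maybe (Fin n) → Fin n → Set
Fits S (just u) y = y ≡ u
Fits S nothing  y = y ∉ S

fits? : (S : List (Fin n)) (m : Maybe (Fin n)) (y : Fin n) → Dec (Fits S m y)
fits? S (just u) y = y ≟ u
fits? S nothing  y = ¬? (y ∈? S)

Filling : List (Fin n) → Pattern n k → Vec (Fin n) k → Set
Filling S c w = Injective w × (∀ i → Fits S (c i) (lookup w i))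

filling? : (S : List (Fin n)) (c : Pattern n k) → Decidable (Filling S c)
filling? S c w = injective? w ×-dec all? (λ i → fits? S (c i) (lookup w i))

isFree : Maybe A → ℕ
isFree (just _) = 0
isFree nothing  = 1

free : Pattern n k → ℕ
free {k = k} c = ∑[ i < k ] isFree (c i)

record Compatible (S : List (Fin n)) (c : Pattern n k) : Set where
  field
    reserved : ∀ {i u} → c i ≡ just u → u ∈ S
    once     : ∀ {i j u} → c i ≡ just u → c j ≡ just u → i ≡ j
open Compatible

_↓_ : ℕ → ℕ → ℕ
m ↓ zero  = 1
m ↓ suc f = m * (pred m ↓ f)

↓-self : ∀ m → m ↓ m ≡ m !
↓-self zero    = refl
↓-self (suc m) = cong (suc m *_) (↓-self m)

fits-narrow : ∀ {S : List (Fin n)} {x y} m → Fits (x ∷ S) m y → Fits S m y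
fits-narrow (just u) y≡u  = y≡u
fits-narrow nothing  y∉xS = y∉xS ∘ there

fits-widen : ∀ {S : List (Fin n)} {x y} m → Fits S m y → x ≢ y → Fits (x ∷ S) m y
fits-widen (just u) y≡u _   = y≡u
fits-widen nothing  y∉S x≢y (here y≡x)  = x≢y (sym y≡x)
fits-widen nothing  y∉S x≢y (there y∈S) = y∉S y∈S

fits-fresh : ∀ {S : List (Fin n)} {c : Pattern n k} {x y} → Compatible S c → x ∉ S →
  ∀ i → Fits (x ∷ S) (c i) y → x ≢ y
fits-fresh {c = c} comp x∉S i fits x≡y with c i in cᵢ
... | just v  = x∉S (subst (_∈ _) (sym (trans x≡y fits)) (reserved comp cᵢ))
... | nothing = fits (here (sym x≡y))

fits-prescribed : ∀ {S : List (Fin n)} {c : Pattern n k} {u y j} → Compatible S c → c j ≡ just u →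
  ∀ i → j ≢ i → Fits S (c i) y → u ≢ y
fits-prescribed {c = c} comp cⱼ i j≢i fits u≡y with c i in cᵢ
... | just v  = j≢i (once comp cⱼ (trans cᵢ (cong just (sym (trans u≡y fits)))))
... | nothing = fits (subst (_∈ _) u≡y (reserved comp cⱼ))

compatible-tail : ∀ {S : List (Fin n)} {c : Pattern n (suc k)} → Compatible S c → Compatible S (c ∘ suc)
compatible-tail comp = record { reserved = reserved comp ; once = λ e₁ e₂ → suc-injective (once comp e₁ e₂) }

compatible-∷ : ∀ {S : List (Fin n)} {c : Pattern n k} {x} → Compatible S c → Compatible (x ∷ S) c
compatible-∷ comp = record { reserved = there ∘ reserved comp ; once = once comp }

filling-prescribed : ∀ {S : List (Fin n)} {c : Pattern n (suc k)} {u x} → Compatible S c → c zero ≡ just u →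
  (λ w → Filling S c (x ∷ w)) ≐ (λ w → x ≡ u × Filling S (c ∘ suc) w)
filling-prescribed {S = S} {c} {u} {x} comp c₀ = to , from
  where
  to : (λ w → Filling S c (x ∷ w)) ⊆ (λ w → x ≡ u × Filling S (c ∘ suc) w)
  to (_ ∷ inj , fits) = subst (λ m → Fits S m x) c₀ (fits zero) , inj , fits ∘ suc
  from : (λ w → x ≡ u × Filling S (c ∘ suc) w) ⊆ (λ w → Filling S c (x ∷ w))
  from {w} (refl , inj , fits) = fresh-∷ w (λ i → fits-prescribed comp c₀ (suc i) (λ ()) (fits i)) inj , fits′
    where
    fits′ : ∀ i → Fits S (c i) (lookup (x ∷ w) i)
    fits′ zero    = subst (λ m → Fits S m x) (sym c₀) refl
    fits′ (suc i) = fits i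

filling-free : ∀ {S : List (Fin n)} {c : Pattern n (suc k)} {x} → Compatible S c → c zero ≡ nothing →
  (λ w → Filling S c (x ∷ w)) ≐ (λ w → x ∉ S × Filling (x ∷ S) (c ∘ suc) w)
filling-free {S = S} {c} {x} comp c₀ = to , from
  where
  to : (λ w → Filling S c (x ∷ w)) ⊆ (λ w → x ∉ S × Filling (x ∷ S) (c ∘ suc) w)
  to (x∉w ∷ inj , fits) =
    subst (λ m → Fits S m x) c₀ (fits zero) , inj ,
    λ i → fits-widen (c (suc i)) (fits (suc i)) (VecAll.lookup⁺ (VecAll.toList⁻ x∉w) i)
  from : (λ w → x ∉ S × Filling (x ∷ S) (c ∘ suc) w) ⊆ (λ w → Filling S c (x ∷ w))
  from {w} (x∉S , inj , fits) = fresh-∷ w (λ i → fits-fresh (compatible-tail comp) x∉S i (fits i)) inj , fits′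
    where
    fits′ : ∀ i → Fits S (c i) (lookup (x ∷ w) i)
    fits′ zero    = subst (λ m → Fits S m x) (sym c₀) x∉S
    fits′ (suc i) = fits-narrow (c (suc i)) (fits i)

-- The number of fillings of a compatible pattern is a falling factorial:
-- each free position, in turn, takes one of the letters not yet reserved.
FillingCount : ℕ → ℕ → Set
FillingCount n k = ∀ {S : List (Fin n)} {c : Pattern n k} → Unique S → Compatible S c →
  count (filling? S c) (words n k) ≡ (n ∸ length S) ↓ free c

fillings-prescribed : FillingCount n k → ∀ {S : List (Fin n)} {c : Pattern n (suc k)} {u} →
  Unique S → Compatible S c → c zero ≡ just u → count (filling? S c) (words n (suc k)) ≡ (n ∸ length S) ↓ free c
fillings-prescribed {n} {k} count-k {S} {c} {u} S-unique comp c₀ = begin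
  count (filling? S c) (words n (suc k))                              ≡⟨ count-words-suc (filling? S c) ⟩
  ∑[ x < n ] count (filling? S c ∘ (x ∷_)) (words n k)                ≡⟨ sum-cong-≗ first-letter ⟩
  ∑[ x < n ] (𝟙 (x ≟ u) * count (filling? S (c ∘ suc)) (words n k))   ≡⟨ ∑-pick u _ ⟩
  count (filling? S (c ∘ suc)) (words n k)                            ≡⟨ count-k S-unique (compatible-tail comp) ⟩
  (n ∸ length S) ↓ free (c ∘ suc)                                     ≡⟨ cong (λ m → (n ∸ length S) ↓ (isFree m + free (c ∘ suc))) c₀ ⟨
  (n ∸ length S) ↓ free c                                             ∎
  where
  open ≡-Reasoning
  first-letter : ∀ x → count (filling? S c ∘ (x ∷_)) (words n k) ≡ 𝟙 (x ≟ u) * count (filling? S (c ∘ suc)) (words n k)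
  first-letter x = trans (count-cong _ (λ w → (x ≟ u) ×-dec filling? S (c ∘ suc) w) (filling-prescribed comp c₀) (words n k))
                         (count-guard (x ≟ u) (filling? S (c ∘ suc)) (words n k))

fillings-free : FillingCount n k → ∀ {S : List (Fin n)} {c : Pattern n (suc k)} →
  Unique S → Compatible S c → c zero ≡ nothing → count (filling? S c) (words n (suc k)) ≡ (n ∸ length S) ↓ free c
fillings-free {n} {k} count-k {S} {c} S-unique comp c₀ = begin
  count (filling? S c) (words n (suc k))                  ≡⟨ count-words-suc (filling? S c) ⟩
  ∑[ x < n ] count (filling? S c ∘ (x ∷_)) (words n k)    ≡⟨ sum-cong-≗ first-letter ⟩
  ∑[ x < n ] (𝟙 (¬? (x ∈? S)) * rest)                     ≡⟨ *-distribʳ-sum rest (λ x → 𝟙 (¬? (x ∈? S))) ⟨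
  ∑[ x < n ] 𝟙 (¬? (x ∈? S)) * rest                       ≡⟨ cong (_* rest) (∑-∉ S-unique) ⟩
  (n ∸ length S) * rest                                   ≡⟨ cong (λ m → (n ∸ length S) * (m ↓ free (c ∘ suc))) (pred[m∸n]≡m∸[1+n] n (length S)) ⟨
  (n ∸ length S) ↓ suc (free (c ∘ suc))                   ≡⟨ cong (λ m → (n ∸ length S) ↓ (isFree m + free (c ∘ suc))) c₀ ⟨
  (n ∸ length S) ↓ free c                                 ∎
  where
  open ≡-Reasoning
  rest = (n ∸ suc (length S)) ↓ free (c ∘ suc)
  first-letter : ∀ x → count (filling? S c ∘ (x ∷_)) (words n k) ≡ 𝟙 (¬? (x ∈? S)) * rest
  first-letter x = begin
    count (filling? S c ∘ (x ∷_)) (words n k)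
      ≡⟨ count-cong _ (λ w → ¬? (x ∈? S) ×-dec filling? (x ∷ S) (c ∘ suc) w) (filling-free comp c₀) (words n k) ⟩
    count (λ w → ¬? (x ∈? S) ×-dec filling? (x ∷ S) (c ∘ suc) w) (words n k)
      ≡⟨ count-guard (¬? (x ∈? S)) (filling? (x ∷ S) (c ∘ suc)) (words n k) ⟩
    𝟙 (¬? (x ∈? S)) * count (filling? (x ∷ S) (c ∘ suc)) (words n k)
      ≡⟨ 𝟙-guarded (¬? (x ∈? S)) (λ x∉S → count-k (¬Any⇒All¬ S x∉S ∷ S-unique) (compatible-∷ (compatible-tail comp))) ⟩
    𝟙 (¬? (x ∈? S)) * rest ∎

count-fillings : ∀ n k → FillingCount n k
count-fillings n zero {S} {c} _ _ =
  trans (count-∷ (filling? S c) [] []) (cong (_+ 0) (𝟙-yes ([] , λ ()) (filling? S c [])))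
count-fillings n (suc k) {S} {c} S-unique comp = by-first-entry (c zero) refl
  where
  by-first-entry : ∀ m → c zero ≡ m → count (filling? S c) (words n (suc k)) ≡ (n ∸ length S) ↓ free c
  by-first-entry (just _) c₀ = fillings-prescribed (count-fillings n k) S-unique comp c₀
  by-first-entry nothing  c₀ = fillings-free (count-fillings n k) S-unique comp c₀

positions : List (Fin k × Fin n) → List (Fin k)
positions = map proj₁

letters : List (Fin k × Fin n) → List (Fin n)
letters = map proj₂

Satisfies : Vec (Fin n) k → List (Fin k × Fin n) → Set
Satisfies w L = All (λ c → lookup w (proj₁ c) ≡ proj₂ c) L

satisfies? : (w : Vec (Fin n) k) (L : List (Fin k × Fin n)) → Dec (Satisfies w L)
satisfies? w L = All.all? (λ c → lookup w (proj₁ c) ≟ proj₂ c) L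

patternOf : List (Fin k × Fin n) → Pattern n k
patternOf []            i = nothing
patternOf ((j , v) ∷ L) i = if does (j ≟ i) then just v else patternOf L i

patternOf-just : ∀ (L : List (Fin k × Fin n)) {i u} → patternOf L i ≡ just u → (i , u) ∈ L
patternOf-just ((j , v) ∷ L) {i} e with j ≟ i
patternOf-just ((j , v) ∷ L) refl | yes refl = here refl
... | no _ = there (patternOf-just L e)

patternOf-nothing : ∀ (L : List (Fin k × Fin n)) {i} → patternOf L i ≡ nothing → i ∉ positions L
patternOf-nothing ((j , v) ∷ L) {i} e i∈ with j ≟ i | i∈
... | yes _   | _           = case e of λ ()
... | no j≢i  | here i≡j    = j≢i (sym i≡j)
... | no _    | there i∈L   = patternOf-nothing L e i∈L

patternOf-∈ : ∀ (L : List (Fin k × Fin n)) {i v} → Unique (positions L) → (i , v) ∈ L → patternOf L i ≡ just v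
patternOf-∈ ((j , v) ∷ L) {i} (j∉L ∷ L-unique) iv∈ with j ≟ i | iv∈
... | yes _    | here refl  = refl
... | yes refl | there iv∈L = contradiction refl (All.lookup j∉L (∈-map⁺ proj₁ iv∈L))
... | no j≢i   | here refl  = contradiction refl j≢i
... | no _     | there iv∈L = patternOf-∈ L L-unique iv∈L

free-patternOf : ∀ (L : List (Fin k × Fin n)) → Unique (positions L) → free (patternOf L) ≡ k ∸ length L
free-patternOf {k} L L-unique = begin
  ∑[ i < k ] isFree (patternOf L i)          ≡⟨ sum-cong-≗ (λ i → isFree-patternOf i (patternOf L i) refl) ⟩
  ∑[ i < k ] 𝟙 (¬? (i ∈? positions L))      ≡⟨ ∑-∉ L-unique ⟩
  k ∸ length (positions L)                   ≡⟨ cong (k ∸_) (length-map proj₁ L) ⟩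
  k ∸ length L                               ∎
  where
  open ≡-Reasoning
  isFree-patternOf : ∀ i m → patternOf L i ≡ m → isFree m ≡ 𝟙 (¬? (i ∈? positions L))
  isFree-patternOf i (just u) e = sym (𝟙-no (λ i∉L → i∉L (∈-map⁺ proj₁ (patternOf-just L e))) (¬? (i ∈? positions L)))
  isFree-patternOf i nothing  e = sym (𝟙-yes (patternOf-nothing L e) (¬? (i ∈? positions L)))

compatible-patternOf : ∀ (L : List (Fin k × Fin n)) → Unique (letters L) → Compatible (letters L) (patternOf L)
compatible-patternOf L L-unique = record
  { reserved = λ e → ∈-map⁺ proj₂ (patternOf-just L e)
  ; once     = λ e₁ e₂ → same-letter L L-unique (patternOf-just L e₁) (patternOf-just L e₂)
  }
  where
  same-letter : ∀ (L : List (Fin k × Fin n)) → Unique (letters L) → ∀ {i j u} → (i , u) ∈ L → (j , u) ∈ L → i ≡ j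
  same-letter (_ ∷ L) _              (here refl)  (here refl)  = refl
  same-letter (_ ∷ L) (u∉L ∷ _)      (here refl)  (there ju∈L) = contradiction refl (All.lookup u∉L (∈-map⁺ proj₂ ju∈L))
  same-letter (_ ∷ L) (u∉L ∷ _)      (there iu∈L) (here refl)  = contradiction refl (All.lookup u∉L (∈-map⁺ proj₂ iu∈L))
  same-letter (_ ∷ L) (_ ∷ L-unique) (there iu∈L) (there ju∈L) = same-letter L L-unique iu∈L ju∈L

letters-distinct : ∀ (w : Vec (Fin n) k) (L : List (Fin k × Fin n)) → Unique (positions L) →
  Injective w → Satisfies w L → Unique (letters L)
letters-distinct w []            _                 _   _              = []
letters-distinct w ((i , v) ∷ L) (i∉L ∷ L-unique) inj (wi≡v ∷ sat) =
  All.tabulate (λ {u} u∈L → new-letter u (∈-map⁻ proj₂ u∈L)) ∷ letters-distinct w L L-unique inj sat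
  where
  new-letter : ∀ u → ∃ (λ c → c ∈ L × u ≡ proj₂ c) → v ≢ u
  new-letter u ((j , v′) , jv′∈L , refl) v≡u =
    All.lookup i∉L (∈-map⁺ proj₁ jv′∈L) (lookup-injective w inj i j (trans wi≡v (trans v≡u (sym (All.lookup sat jv′∈L)))))

satisfies⇔filling : ∀ (L : List (Fin k × Fin n)) → Unique (positions L) →
  (λ w → Injective w × Satisfies w L) ≐ Filling (letters L) (patternOf L)
satisfies⇔filling L L-unique = to , from
  where
  to : (λ w → Injective w × Satisfies w L) ⊆ Filling (letters L) (patternOf L)
  to {w} (inj , sat) = inj , λ i → fits i (patternOf L i) refl
    where
    fits : ∀ i m → patternOf L i ≡ m → Fits (letters L) m (lookup w i)
    fits i (just u) e = All.lookup sat (patternOf-just L e)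
    fits i nothing  e wi∈ with ∈-map⁻ proj₂ wi∈
    ... | (j , v) , jv∈L , wi≡v = patternOf-nothing L e
            (subst (_∈ positions L) (lookup-injective w inj j i (trans (All.lookup sat jv∈L) (sym wi≡v))) (∈-map⁺ proj₁ jv∈L))
  from : Filling (letters L) (patternOf L) ⊆ (λ w → Injective w × Satisfies w L)
  from {w} (inj , fits) = inj , All.tabulate λ {(i , v)} iv∈L → subst (λ m → Fits (letters L) m (lookup w i)) (patternOf-∈ L L-unique iv∈L) (fits i)

count-constrained : ∀ (L : List (Fin k × Fin n)) → Unique (positions L) →
  count (λ w → injective? w ×-dec satisfies? w L) (words n k) ≡ 𝟙 (distinct? (letters L)) * ((n ∸ length L) ↓ (k ∸ length L))
count-constrained {k} {n} L L-unique with distinct? (letters L)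
... | no repeated = count-none _ (λ w (inj , sat) → repeated (letters-distinct w L L-unique inj sat)) (words n k)
... | yes L-distinct = begin
  count (λ w → injective? w ×-dec satisfies? w L) (words n k)  ≡⟨ count-cong _ _ (satisfies⇔filling L L-unique) (words n k) ⟩
  count (filling? (letters L) (patternOf L)) (words n k)       ≡⟨ count-fillings n k L-distinct (compatible-patternOf L L-distinct) ⟩
  (n ∸ length (letters L)) ↓ free (patternOf L)               ≡⟨ cong₂ (λ a b → (n ∸ a) ↓ b) (length-map proj₂ L) (free-patternOf L L-unique) ⟩
  (n ∸ length L) ↓ (k ∸ length L)                             ≡⟨ +-identityʳ _ ⟨
  1 * ((n ∸ length L) ↓ (k ∸ length L))                        ∎
  where open ≡-Reasoning

Constrained : List (Fin n × Fin n) → Vec (Fin n) n → Set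
Constrained L σ = Injective σ × Satisfies σ L

constrained? : (L : List (Fin n × Fin n)) → Decidable (Constrained L)
constrained? L σ = isPerm? σ ×-dec satisfies? σ L

count-perms-constrained : ∀ (L : List (Fin n × Fin n)) → Unique (positions L) →
  count (constrained? L) (words n n) ≡ 𝟙 (distinct? (letters L)) * (n ∸ length L) !
count-perms-constrained {n} L L-unique =
  trans (count-constrained L L-unique) (cong (𝟙 (distinct? (letters L)) *_) (↓-self (n ∸ length L)))

Restricted : (p q r s a b : Fin n) → Vec (Fin n) n → Set
Restricted p q r s a b σ = Injective σ × lookup σ q < lookup σ p × lookup σ a ≡ r × lookup σ b ≡ s

restricted? : (p q r s a b : Fin n) → Decidable (Restricted p q r s a b)
restricted? p q r s a b σ =
  isPerm? σ ×-dec ((lookup σ q <? lookup σ p) ×-dec ((lookup σ a ≟ r) ×-dec (lookup σ b ≟ s)))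

#SpqRestr : ∀ n (p q r s a b : Fin n) → # SpqRestr n p q r s a b ≡ count (restricted? p q r s a b) (words n n)
#SpqRestr n p q r s a b = trans (count-filter (λ σ → lookup σ q <? lookup σ p) _ (Sym n)) (count-filter isPerm? _ (words n n))

count-guarded-perms : ∀ {ℓ} {B : Set ℓ} {R : Pred (Vec (Fin n) n) ℓ′} (L : List (Fin n × Fin n)) →
  Unique (positions L) → (b? : Dec B) (R? : Decidable R) → R ≐ (λ σ → B × Constrained L σ) →
  count R? (words n n) ≡ 𝟙 b? * (𝟙 (distinct? (letters L)) * (n ∸ length L) !)
count-guarded-perms {n} L L-unique b? R? R≐ = begin
  count R? (words n n)                                      ≡⟨ count-cong R? (λ σ → b? ×-dec constrained? L σ) R≐ (words n n) ⟩
  count (λ σ → b? ×-dec constrained? L σ) (words n n)       ≡⟨ count-guard b? (constrained? L) (words n n) ⟩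
  𝟙 b? * count (constrained? L) (words n n)                 ≡⟨ cong (𝟙 b? *_) (count-perms-constrained L L-unique) ⟩
  𝟙 b? * (𝟙 (distinct? (letters L)) * (n ∸ length L) !)    ∎
  where open ≡-Reasoning

-- If the compared positions are the constrained ones, the comparison is r < s.
count-pinned : ∀ {p q r s : Fin n} → q ≢ p → r < s → # SpqRestr n p q r s q p ≡ (n ∸ 2) !
count-pinned {n} {p} {q} {r} {s} q≢p r<s = begin
  # SpqRestr n p q r s q p                                           ≡⟨ #SpqRestr n p q r s q p ⟩
  count (restricted? p q r s q p) (words n n)                        ≡⟨ count-cong _ _ (to , from) (words n n) ⟩
  count (constrained? L) (words n n)                                 ≡⟨ count-perms-constrained L (distinct₂ q≢p) ⟩
  𝟙 (distinct? (r ∷ s ∷ [])) * (n ∸ 2) !                             ≡⟨ cong (_* (n ∸ 2) !) (𝟙-yes (distinct₂ (<⇒≢ r<s)) (distinct? (r ∷ s ∷ []))) ⟩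
  1 * (n ∸ 2) !                                                      ≡⟨ +-identityʳ _ ⟩
  (n ∸ 2) !                                                          ∎
  where
  open ≡-Reasoning
  L : List (Fin n × Fin n)
  L = (q , r) ∷ (p , s) ∷ []
  to : Restricted p q r s q p ⊆ Constrained L
  to (perm , _ , σq≡r , σp≡s) = perm , σq≡r ∷ σp≡s ∷ []
  from : Constrained L ⊆ Restricted p q r s q p
  from (perm , σq≡r ∷ σp≡s ∷ []) = perm , subst₂ _<_ (sym σq≡r) (sym σp≡s) r<s , σq≡r , σp≡s

count-opposite : ∀ {p q r s a b : Fin n} → p ≢ q → a ≢ b → r ≢ s →
  # SpqRestr n p q r s a b + # SpqRestr n q p r s a b ≡ (n ∸ 2) !
count-opposite {n} {p} {q} {r} {s} {a} {b} p≢q a≢b r≢s = begin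
  # SpqRestr n p q r s a b + # SpqRestr n q p r s a b
    ≡⟨ cong₂ _+_ (#SpqRestr n p q r s a b) (#SpqRestr n q p r s a b) ⟩
  count (restricted? p q r s a b) (words n n) + count (restricted? q p r s a b) (words n n)
    ≡⟨ cong₂ _+_ (count-cong _ _ (to-pq , from-pq) (words n n)) (count-cong _ _ (to-qp , from-qp) (words n n)) ⟩
  count (constrained? L ∩? compared) (words n n) + count (constrained? L ∩? ∁? compared) (words n n)
    ≡⟨ count-split (constrained? L) compared (words n n) ⟨
  count (constrained? L) (words n n)
    ≡⟨ count-perms-constrained L (distinct₂ a≢b) ⟩
  𝟙 (distinct? (r ∷ s ∷ [])) * (n ∸ 2) !
    ≡⟨ cong (_* (n ∸ 2) !) (𝟙-yes (distinct₂ r≢s) (distinct? (r ∷ s ∷ []))) ⟩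
  1 * (n ∸ 2) !
    ≡⟨ +-identityʳ _ ⟩
  (n ∸ 2) ! ∎
  where
  open ≡-Reasoning
  L : List (Fin n × Fin n)
  L = (a , r) ∷ (b , s) ∷ []
  compared : Decidable (λ (σ : Vec (Fin n) n) → lookup σ q < lookup σ p)
  compared σ = lookup σ q <? lookup σ p
  to-pq : Restricted p q r s a b ⊆ (Constrained L ∩ (λ σ → lookup σ q < lookup σ p))
  to-pq (perm , σq<σp , σa≡r , σb≡s) = (perm , σa≡r ∷ σb≡s ∷ []) , σq<σp
  from-pq : (Constrained L ∩ (λ σ → lookup σ q < lookup σ p)) ⊆ Restricted p q r s a b
  from-pq ((perm , σa≡r ∷ σb≡s ∷ []) , σq<σp) = perm , σq<σp , σa≡r , σb≡s
  to-qp : Restricted q p r s a b ⊆ (Constrained L ∩ ∁ (λ σ → lookup σ q < lookup σ p))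
  to-qp (perm , σp<σq , σa≡r , σb≡s) = (perm , σa≡r ∷ σb≡s ∷ []) , <-asym σp<σq
  from-qp : (Constrained L ∩ ∁ (λ σ → lookup σ q < lookup σ p)) ⊆ Restricted q p r s a b
  from-qp {σ} ((perm , σa≡r ∷ σb≡s ∷ []) , σq≮σp) = perm , σp<σq , σa≡r , σb≡s
    where
    σp<σq : lookup σ p < lookup σ q
    σp<σq with <-cmp (lookup σ p) (lookup σ q)
    ... | tri< σp<σq _ _ = σp<σq
    ... | tri≈ _ σp≡σq _ = contradiction (lookup-injective σ perm p q σp≡σq) p≢q
    ... | tri> _ _ σq<σp = contradiction σq<σp σq≮σp

-- When exactly one compared position z is unconstrained, the comparison
-- σ(q) < σ(p) amounts to a condition A on the letter σ(z).  Classifying by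
-- that letter t, each admissible t ∉ {r, s} contributes (n ∸ 3)! permutations.
count-one-free : ∀ {n ℓ} {p q r s a b z : Fin n} {A : Pred (Fin n) ℓ} (A? : Decidable A) →
  Unique (a ∷ b ∷ z ∷ []) → r ≢ s →
  (∀ {σ : Vec (Fin n) n} → lookup σ a ≡ r → lookup σ b ≡ s → (lookup σ q < lookup σ p) ⇔ A (lookup σ z)) →
  # SpqRestr n p q r s a b ≡ (∑[ t < n ] 𝟙 (A? t) ∸ (𝟙 (A? r) + 𝟙 (A? s))) * (n ∸ 3) !
count-one-free {n} {ℓ} {p} {q} {r} {s} {a} {b} {z} {A} A? abz r≢s comparison = begin
  # SpqRestr n p q r s a b
    ≡⟨ #SpqRestr n p q r s a b ⟩
  count (restricted? p q r s a b) (words n n)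
    ≡⟨ count-fibres (restricted? p q r s a b) (λ σ → lookup σ z) (words n n) ⟩
  ∑[ t < n ] count (restricted? p q r s a b ∩? λ σ → lookup σ z ≟ t) (words n n)
    ≡⟨ sum-cong-≗ (λ t → count-guarded-perms (L t) abz (A? t) _ (to t , from t)) ⟩
  ∑[ t < n ] (𝟙 (A? t) * (avoids t * (n ∸ 3) !))
    ≡⟨ sum-cong-≗ (λ t → trans (sym (*-assoc (𝟙 (A? t)) _ _)) (cong (_* (n ∸ 3) !) (*-comm (𝟙 (A? t)) (avoids t)))) ⟩
  ∑[ t < n ] (avoids t * 𝟙 (A? t) * (n ∸ 3) !)
    ≡⟨ *-distribʳ-sum ((n ∸ 3) !) (λ t → avoids t * 𝟙 (A? t)) ⟨
  ∑[ t < n ] (avoids t * 𝟙 (A? t)) * (n ∸ 3) !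
    ≡⟨ cong (_* (n ∸ 3) !) (∑-avoiding r≢s (λ t → 𝟙 (A? t))) ⟩
  (∑[ t < n ] 𝟙 (A? t) ∸ (𝟙 (A? r) + 𝟙 (A? s))) * (n ∸ 3) ! ∎
  where
  open ≡-Reasoning
  avoids : Fin n → ℕ
  avoids t = 𝟙 (distinct? (r ∷ s ∷ t ∷ []))
  L : Fin n → List (Fin n × Fin n)
  L t = (a , r) ∷ (b , s) ∷ (z , t) ∷ []
  to : ∀ t → (Restricted p q r s a b ∩ λ σ → lookup σ z ≡ t) ⊆ (λ σ → A t × Constrained (L t) σ)
  to t {σ} ((perm , σq<σp , σa≡r , σb≡s) , σz≡t) =
    subst A σz≡t (Equivalence.to (comparison {σ} σa≡r σb≡s) σq<σp) , perm , σa≡r ∷ σb≡s ∷ σz≡t ∷ []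
  from : ∀ t → (λ σ → A t × Constrained (L t) σ) ⊆ (Restricted p q r s a b ∩ λ σ → lookup σ z ≡ t)
  from t {σ} (At , perm , σa≡r ∷ σb≡s ∷ σz≡t ∷ []) =
    (perm , Equivalence.from (comparison {σ} σa≡r σb≡s) (subst A (sym σz≡t) At) , σa≡r , σb≡s) , σz≡t

-- When neither compared position is constrained, classify by the pair of letters
-- (σ(p), σ(q)) = (t₁, t₂); the result depends only on r and s.
pairCount : (r s : Fin n) → ℕ
pairCount {n} r s = ∑[ t₁ < n ] (∑[ t₂ < n ] (𝟙 (t₂ <? t₁) * (𝟙 (distinct? (r ∷ s ∷ t₁ ∷ t₂ ∷ [])) * (n ∸ 4) !)))

count-free-pair : ∀ {p q r s a b : Fin n} → Unique (a ∷ b ∷ p ∷ q ∷ []) → # SpqRestr n p q r s a b ≡ pairCount r s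
count-free-pair {n} {p} {q} {r} {s} {a} {b} abpq = begin
  # SpqRestr n p q r s a b
    ≡⟨ #SpqRestr n p q r s a b ⟩
  count (restricted? p q r s a b) (words n n)
    ≡⟨ count-fibres (restricted? p q r s a b) (λ σ → lookup σ p) (words n n) ⟩
  ∑[ t₁ < n ] count (fibre t₁) (words n n)
    ≡⟨ sum-cong-≗ (λ t₁ → count-fibres (fibre t₁) (λ σ → lookup σ q) (words n n)) ⟩
  ∑[ t₁ < n ] (∑[ t₂ < n ] count (fibre t₁ ∩? λ σ → lookup σ q ≟ t₂) (words n n))
    ≡⟨ sum-cong-≗ (λ t₁ → sum-cong-≗ λ t₂ → count-guarded-perms (L t₁ t₂) abpq (t₂ <? t₁) _ (to t₁ t₂ , from t₁ t₂)) ⟩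
  pairCount r s ∎
  where
  open ≡-Reasoning
  fibre : (t₁ : Fin n) → Decidable (Restricted p q r s a b ∩ λ σ → lookup σ p ≡ t₁)
  fibre t₁ = restricted? p q r s a b ∩? λ σ → lookup σ p ≟ t₁
  L : Fin n → Fin n → List (Fin n × Fin n)
  L t₁ t₂ = (a , r) ∷ (b , s) ∷ (p , t₁) ∷ (q , t₂) ∷ []
  to : ∀ t₁ t₂ → ((Restricted p q r s a b ∩ λ σ → lookup σ p ≡ t₁) ∩ λ σ → lookup σ q ≡ t₂)
                 ⊆ (λ σ → t₂ < t₁ × Constrained (L t₁ t₂) σ)
  to t₁ t₂ (((perm , σq<σp , σa≡r , σb≡s) , σp≡t₁) , σq≡t₂) =
    subst₂ _<_ σq≡t₂ σp≡t₁ σq<σp , perm , σa≡r ∷ σb≡s ∷ σp≡t₁ ∷ σq≡t₂ ∷ []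
  from : ∀ t₁ t₂ → (λ σ → t₂ < t₁ × Constrained (L t₁ t₂) σ)
                   ⊆ ((Restricted p q r s a b ∩ λ σ → lookup σ p ≡ t₁) ∩ λ σ → lookup σ q ≡ t₂)
  from t₁ t₂ (t₂<t₁ , perm , σa≡r ∷ σb≡s ∷ σp≡t₁ ∷ σq≡t₂ ∷ []) =
    ((perm , subst₂ _<_ (sym σq≡t₂) (sym σp≡t₁) t₂<t₁ , σa≡r , σb≡s) , σp≡t₁) , σq≡t₂

-- Since pairCount r s does not depend on the order of p and q, both orders
-- account for half of the (n ∸ 2)! permutations with σ(a) = r, σ(b) = s.
count-half : ∀ {p q r s a b : Fin n} → a ≢ b → a ≢ p → a ≢ q → b ≢ p → b ≢ q → p ≢ q → r ≢ s →
  # SpqRestr n p q r s a b ≡ (n ∸ 2) ! / 2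
count-half {n} {p} {q} {r} {s} {a} {b} a≢b a≢p a≢q b≢p b≢q p≢q r≢s = begin
  # SpqRestr n p q r s a b   ≡⟨ count-free-pair (distinct₄ a≢b a≢p a≢q b≢p b≢q p≢q) ⟩
  pairCount r s              ≡⟨ m*n/n≡m (pairCount r s) 2 ⟨
  pairCount r s * 2 / 2      ≡⟨ cong (_/ 2) twice ⟩
  (n ∸ 2) ! / 2              ∎
  where
  open ≡-Reasoning
  twice : pairCount r s * 2 ≡ (n ∸ 2) !
  twice = begin
    pairCount r s * 2                                     ≡⟨ *-comm (pairCount r s) 2 ⟩
    pairCount r s + (pairCount r s + 0)                   ≡⟨ cong (pairCount r s +_) (+-identityʳ (pairCount r s)) ⟩
    pairCount r s + pairCount r s                         ≡⟨ cong₂ _+_ (count-free-pair (distinct₄ a≢b a≢p a≢q b≢p b≢q p≢q))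
                                                                       (count-free-pair (distinct₄ a≢b a≢q a≢p b≢q b≢p (p≢q ∘ sym))) ⟨
    # SpqRestr n p q r s a b + # SpqRestr n q p r s a b   ≡⟨ count-opposite p≢q a≢b r≢s ⟩
    (n ∸ 2) !                                             ∎

-- The configurations of parts (3)–(6), for r < s: one compared position is
-- constrained (to r at position a, or to s at position b), the other one, z, is free,
-- and σ(z) is compared with r or s.
-- σ(z) < σ(a) = r: the toℕ r letters below r, none of which is r or s.
below-first : ∀ {r s a b z : Fin n} → Unique (a ∷ b ∷ z ∷ []) → r < s → # SpqRestr n a z r s a b ≡ toℕ r * (n ∸ 3) !
below-first {n} {r} {s} abz r<s =
  trans (count-one-free (_<? r) abz (<⇒≢ r<s) λ σa≡r _ → mk⇔ (subst (_ <_) σa≡r) (subst (_ <_) (sym σa≡r)))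
        (cong (_* (n ∸ 3) !) (cong₂ _∸_ (∑-below r) (cong₂ _+_ (𝟙-no (<-irrefl refl) (r <? r)) (𝟙-no (<-asym r<s) (s <? r)))))

-- σ(a) = r < σ(z): the letters above r, except s.
above-first : ∀ {r s a b z : Fin n} → Unique (a ∷ b ∷ z ∷ []) → r < s → # SpqRestr n z a r s a b ≡ (n ∸ suc (toℕ r) ∸ 1) * (n ∸ 3) !
above-first {n} {r} {s} abz r<s =
  trans (count-one-free (r <?_) abz (<⇒≢ r<s) λ σa≡r _ → mk⇔ (subst (_< _) σa≡r) (subst (_< _) (sym σa≡r)))
        (cong (_* (n ∸ 3) !) (cong₂ _∸_ (∑-above r) (cong₂ _+_ (𝟙-no (<-irrefl refl) (r <? r)) (𝟙-yes r<s (r <? s)))))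

-- σ(z) < σ(b) = s: the letters below s, except r.
below-second : ∀ {r s a b z : Fin n} → Unique (a ∷ b ∷ z ∷ []) → r < s → # SpqRestr n b z r s a b ≡ (toℕ s ∸ 1) * (n ∸ 3) !
below-second {n} {r} {s} abz r<s =
  trans (count-one-free (_<? s) abz (<⇒≢ r<s) λ _ σb≡s → mk⇔ (subst (_ <_) σb≡s) (subst (_ <_) (sym σb≡s)))
        (cong (_* (n ∸ 3) !) (cong₂ _∸_ (∑-below s) (cong₂ _+_ (𝟙-yes r<s (r <? s)) (𝟙-no (<-irrefl refl) (s <? s)))))

-- σ(b) = s < σ(z): the letters above s, none of which is r or s.
above-second : ∀ {r s a b z : Fin n} → Unique (a ∷ b ∷ z ∷ []) → r < s → # SpqRestr n z b r s a b ≡ (n ∸ suc (toℕ s)) * (n ∸ 3) !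
above-second {n} {r} {s} abz r<s =
  trans (count-one-free (s <?_) abz (<⇒≢ r<s) λ _ σb≡s → mk⇔ (subst (_< _) σb≡s) (subst (_< _) (sym σb≡s)))
        (cong (_* (n ∸ 3) !) (cong₂ _∸_ (∑-above s) (cong₂ _+_ (𝟙-no (<-asym r<s) (s <? r)) (𝟙-no (<-irrefl refl) (s <? s)))))

-- Each part is one of the configurations above; the formulas hold for every n
-- (with truncated subtraction).
lemma4p1 : (n : ℕ) → 4 ≤ n → (i₁ j₁ i₂ j₂ a b : Fin n) → i₁ < j₁ → i₂ < j₂ →
    -- (1)
    ((# SpqRestr n i₁ j₁ i₂ j₂ j₁ i₁ ≡ (n ∸ 2) !)
      × (# SpqRestr n j₁ i₁ i₂ j₂ i₁ j₁ ≡ (n ∸ 2) !))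
    -- (2)  (a ≠ b is implicit in the paper)
    × (a ≢ i₁ → a ≢ j₁ → b ≢ i₁ → b ≢ j₁ → a ≢ b →
        (# SpqRestr n i₁ j₁ i₂ j₂ a b ≡ (n ∸ 2) ! / 2)
          × (# SpqRestr n j₁ i₁ i₂ j₂ a b ≡ (n ∸ 2) ! / 2))
    -- (3)
    × (b ≢ i₁ → b ≢ j₁ →
        (# SpqRestr n i₁ j₁ i₂ j₂ i₁ b ≡ (pos i₂ ∸ 1) * (n ∸ 3) !)
          × (# SpqRestr n j₁ i₁ i₂ j₂ i₁ b ≡ (n ∸ pos i₂ ∸ 1) * (n ∸ 3) !))
    -- (4)
    × (a ≢ i₁ → a ≢ j₁ →
        (# SpqRestr n i₁ j₁ i₂ j₂ a i₁ ≡ (pos j₂ ∸ 2) * (n ∸ 3) !)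
          × (# SpqRestr n j₁ i₁ i₂ j₂ a i₁ ≡ (n ∸ pos j₂) * (n ∸ 3) !))
    -- (5)
    × (b ≢ i₁ → b ≢ j₁ →
        (# SpqRestr n i₁ j₁ i₂ j₂ j₁ b ≡ (n ∸ pos i₂ ∸ 1) * (n ∸ 3) !)
          × (# SpqRestr n j₁ i₁ i₂ j₂ j₁ b ≡ (pos i₂ ∸ 1) * (n ∸ 3) !))
    -- (6)
    × (a ≢ i₁ → a ≢ j₁ →
        (# SpqRestr n i₁ j₁ i₂ j₂ a j₁ ≡ (n ∸ pos j₂) * (n ∸ 3) !)
          × (# SpqRestr n j₁ i₁ i₂ j₂ a j₁ ≡ (pos j₂ ∸ 2) * (n ∸ 3) !))
lemma4p1 n _ i₁ j₁ i₂ j₂ a b i₁<j₁ i₂<j₂ =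
    (count-pinned j₁≢i₁ i₂<j₂ , count-pinned i₁≢j₁ i₂<j₂)
  , (λ a≢i₁ a≢j₁ b≢i₁ b≢j₁ a≢b → count-half a≢b a≢i₁ a≢j₁ b≢i₁ b≢j₁ i₁≢j₁ i₂≢j₂
                              , count-half a≢b a≢j₁ a≢i₁ b≢j₁ b≢i₁ j₁≢i₁ i₂≢j₂)
  , (λ b≢i₁ b≢j₁ → let i₁bj₁ = distinct₃ (b≢i₁ ∘ sym) i₁≢j₁ b≢j₁
                   in below-first i₁bj₁ i₂<j₂ , above-first i₁bj₁ i₂<j₂)
  , (λ a≢i₁ a≢j₁ → let ai₁j₁ = distinct₃ a≢i₁ a≢j₁ i₁≢j₁
                   in below-second ai₁j₁ i₂<j₂ , above-second ai₁j₁ i₂<j₂)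
  , (λ b≢i₁ b≢j₁ → let j₁bi₁ = distinct₃ (b≢j₁ ∘ sym) j₁≢i₁ b≢i₁
                   in above-first j₁bi₁ i₂<j₂ , below-first j₁bi₁ i₂<j₂)
  , (λ a≢i₁ a≢j₁ → let aj₁i₁ = distinct₃ a≢j₁ a≢i₁ j₁≢i₁
                   in above-second aj₁i₁ i₂<j₂ , below-second aj₁i₁ i₂<j₂)
  where
  i₁≢j₁ : i₁ ≢ j₁
  i₁≢j₁ = <⇒≢ i₁<j₁
  j₁≢i₁ : j₁ ≢ i₁
  j₁≢i₁ = i₁≢j₁ ∘ sym
  i₂≢j₂ : i₂ ≢ j₂
  i₂≢j₂ = <⇒≢ i₂<j₂
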